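{- The class $\{K_e(cp(n)) : n\in\mathbb{N}\}$ of edge-clique graphs of cocktail party graphs has unbounded rankwidth; that is, for every $k$ there exists $n$ such that the rankwidth of $K_e(cp(n))$ exceeds $k$.
   Context: The cocktail party graph $cp(n)$ is the complement of a perfect matching on $2n$ vertices. The edge-clique graph $K_e(G)$ of a graph $G$ has the edges of $G$ as its vertices, two of them adjacent when the corresponding edges are contained in a common clique of $G$. Rankwidth is the standard graph width parameter of Oum and Seymour. -}

module Defs where

open import Data.Nat using (ℕ; zero; suc)
open import Data.Nat.Base using (_<ᵇ_; _≡ᵇ_)
open import Data.Fin using (Fin; toℕ)
open import Data.Bool using (Bool; true; false; _∧_; _∨_; _xor_; not; T)
open import Data.Product using (Σ; _×_; _,_; ∃; proj₁; proj₂)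
open import Data.Sum using (_⊎_)
open import Data.List using (List; [])
open import Data.List.Membership.Propositional using (_∈_; _∉_)
open import Data.List.Relation.Unary.Unique.Propositional using (Unique)
open import Relation.Binary.PropositionalEquality using (_≡_; _≢_)
open import Relation.Nullary using (¬_)
open import Function.Bundles using (_⇔_)

record Graph : Set₁ where
  field
    V   : Set
    Adj : V → V → Set
open Graph public

-- Cocktail party graph cp(n): vertex set Fin n × Bool (2n vertices);
-- the perfect matching pairs (i , false) with (i , true);
-- cp(n) is its complement: (i , a) ~ (j , b)  iff  i ≠ j.

cpV : ℕ → Set
cpV n = Fin n × Bool

cpAdj : (n : ℕ) → cpV n → cpV n → Bool
cpAdj n (i , a) (j , b) = not (toℕ i ≡ᵇ toℕ j)

-- a strict total order on the vertices of cp(n) (lexicographic), used only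
-- to pick one orientation of each unordered edge
cpLt : (n : ℕ) → cpV n → cpV n → Bool
cpLt n (i , a) (j , b) = (toℕ i <ᵇ toℕ j) ∨ ((toℕ i ≡ᵇ toℕ j) ∧ (not a ∧ b))

-- Edge-clique graph K_e(G) for a graph with decidable adjacency `adj`
-- on vertex type V, given a strict total order `lt` on V (used to
-- represent each unordered edge {u,v} uniquely as (u , v) with u < v).

IsClique : {V : Set} → (V → V → Bool) → List V → Set
IsClique {V} adj C = ∀ x y → x ∈ C → y ∈ C → x ≢ y → T (adj x y)

EdgeOf : (V : Set) → (V → V → Bool) → (V → V → Bool) → Set
EdgeOf V adj lt = Σ (V × V) λ uv → T (lt (proj₁ uv) (proj₂ uv) ∧ adj (proj₁ uv) (proj₂ uv))

Ke : (V : Set) → (adj : V → V → Bool) → (lt : V → V → Bool) → Graph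
Ke V adj lt = record
  { V   = EdgeOf V adj lt
  ; Adj = λ e f → e ≢ f × ∃ λ (C : List V) → IsClique adj C
                  × proj₁ (proj₁ e) ∈ C × proj₂ (proj₁ e) ∈ C
                  × proj₁ (proj₁ f) ∈ C × proj₂ (proj₁ f) ∈ C
  }

KeCp : ℕ → Graph
KeCp n = Ke (cpV n) (cpAdj n) (cpLt n)

dot : (r : ℕ) → (Fin r → Bool) → (Fin r → Bool) → Bool
dot zero    u v = false
dot (suc r) u v = (u Fin.zero ∧ v Fin.zero) xor dot r (λ i → u (Fin.suc i)) (λ i → v (Fin.suc i))
  where import Data.Fin as Fin

-- cut-rank: the GF(2)-rank of the X × (V∖X) submatrix of the adjacency
-- matrix is at most r, i.e. that matrix factors as B·C with
-- B : X × r and C : r × (V∖X) over GF(2).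
CutRankAtMost : (G : Graph) → (V G → Set) → ℕ → Set
CutRankAtMost G X r =
  Σ (V G → Fin r → Bool) λ B → Σ (Fin r → V G → Bool) λ C →
    ∀ x y → X x → ¬ X y → (Adj G x y ⇔ T (dot r (B x) (λ i → C i y)))

-- Rank-decompositions, represented as (rooted) binary trees whose leaves
-- are in bijection with the vertices.  The cuts given by the tree edges
-- are exactly (leaves of a subtree , the rest).

data BTree (A : Set) : Set where
  leaf : A → BTree A
  node : BTree A → BTree A → BTree A

leaves : {A : Set} → BTree A → List A
leaves (leaf a)   = a Data.List.∷ []
leaves (node l r) = leaves l Data.List.++ leaves r

data _⊑_ {A : Set} : BTree A → BTree A → Set where
  here  : ∀ {t} → t ⊑ t
  left  : ∀ {s l r} → s ⊑ l → s ⊑ node l r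
  right : ∀ {s l r} → s ⊑ r → s ⊑ node l r

IsRankDecomposition : (G : Graph) → BTree (V G) → Set
IsRankDecomposition G t = Unique (leaves t) × (∀ v → v ∈ leaves t)

-- rankwidth(G) ≤ k  (graphs with at most one vertex have rankwidth 0)
RankwidthAtMost : ℕ → Graph → Set
RankwidthAtMost k G =
  (∀ (u v : V G) → u ≡ v)
  ⊎ Σ (BTree (V G)) λ t → IsRankDecomposition G t
      × (∀ s → s ⊑ t → CutRankAtMost G (λ v → v ∈ leaves s) k)

-- The edges c(i,j) = {(i,true), (j,false)} of cp(n), for i ≠ j, form an n × n grid without its
-- diagonal, and c(i,j), c(k,l) are adjacent in K_e(cp(n)) iff i ≠ l and k ≠ j: a clique of cp(n)
-- never contains both (a,true) and (a,false). Record a set X of edges as the 0/1 matrix telling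
-- which cells lie in X. If X has cut-rank at most k, then in a row i the ones leading to rows with
-- at least two zeros get pairwise different rows of the factor B (a zero c(j,l) ∉ X with l ≠ i is
-- adjacent to c(i,j′) but not to c(i,j)), so there are at most 2^k of them; dually for zeros leading
-- to rows with at least two ones. Now climb a rank-decomposition: at a leaf every row has at least
-- two zeros. At a node whose children have this property, the bounds allow at most 1 + 2·2^k rows
-- with two ones in each child and, if some row of the node has fewer than two zeros, at most
-- 2 + 2^k rows with two zeros in the node. For n > 4 + 5·2^k some row then has at most three
-- off-diagonal entries in total, which is absurd for n ≥ 5. Hence the root, which contains every
-- edge and so has no zeros at all, would have rows with two zeros.

module Submission where

open import Defs
open import Data.Bool using (Bool; true; false; _∧_; _∨_; _xor_; not; T; if_then_else_)
open import Data.Bool.Properties using (T-∧; T-∨; T?; T-irrelevant)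
import Data.Bool.Properties as Bool
open import Data.Empty using (⊥-elim)
import Data.Empty.Irrelevant as Irrelevant
open import Data.Fin using (Fin; zero; suc; toℕ; punchOut; _≟_)
open import Data.Fin.Base using (funToFin; finToFun)
open import Data.Fin.Properties
  using ( ¬Fin0; 0≢1+n; suc-injective; toℕ-injective; punchOut-injective
        ; 2↔Bool; finToFun-funToFin)
open import Data.List using (List; []; _∷_; _++_; map)
open import Data.List.Membership.Propositional using (_∈_; _∉_)
open import Data.List.Membership.Propositional.Properties using (∈-++⁻; ∈-map⁻)
import Data.List.Membership.DecPropositional as DecMembership
open import Data.List.Relation.Unary.Any using (here; there)
open import Data.Nat
  using (ℕ; zero; suc; _+_; _*_; _^_; _≤_; _<_; _≤ᵇ_; _<ᵇ_; _≡ᵇ_; z≤n; s≤s)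
open import Data.Nat.Properties
  using ( ≤-refl; ≤-trans; ≤-reflexive; ≤-pred; +-mono-≤; +-monoʳ-≤; +-monoˡ-≤; +-identityʳ
        ; m≤m+n; n≤1+n; <-cmp; <⇒≢; <⇒≱; ≰⇒>; ≤⇒≤ᵇ; ≤ᵇ⇒≤; <⇒<ᵇ; ≡ᵇ⇒≡; ≡⇒≡ᵇ
        ; +-commutativeSemigroup; module ≤-Reasoning)
open import Algebra.Properties.CommutativeSemigroup +-commutativeSemigroup using (interchange)
open import Data.Nat.Tactic.RingSolver using (solve-∀)
open import Data.Product using (Σ; ∃; _×_; _,_; proj₁; proj₂)
import Data.Product as Product
open import Data.Product.Properties using (≡-dec)
open import Data.Sum using (_⊎_; inj₁; inj₂)
import Data.Sum as Sum
open import Function using (_∘_; id; const)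
open import Function.Bundles using (_⇔_; Equivalence; Inverse; mk⇔)
open import Relation.Binary.Definitions using (DecidableEquality; tri<; tri≈; tri>)
open import Relation.Binary.PropositionalEquality
open import Relation.Nullary using (¬_; yes; no; contradiction)
open import Relation.Nullary.Decidable using (⌊_⌋; toWitness; fromWitness)

private
  variable
    n r : ℕ

∧-reassoc : ∀ a b {c} → T (a ∧ (b ∧ c)) → T (a ∧ b) × T c
∧-reassoc a b h with Equivalence.to (T-∧ {a}) h
... | ha , hbc with Equivalence.to (T-∧ {b}) hbc
...   | hb , hc = Equivalence.from T-∧ (ha , hb) , hc

T-not-≡ᵇ : ∀ {a b} → T (not (a ≡ᵇ b)) ⇔ (a ≢ b)
T-not-≡ᵇ {a} {b} with a ≡ᵇ b in a≡ᵇb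
... | true  = mk⇔ (λ ()) (λ a≢b → a≢b (≡ᵇ⇒≡ a b (subst T (sym a≡ᵇb) _)))
... | false = mk⇔ (λ _ a≡b → subst T a≡ᵇb (≡⇒≡ᵇ a b a≡b)) _

∈⇒∉⇒≢ : ∀ {A : Set} {L : List A} {x y} → x ∈ L → y ∉ L → x ≢ y
∈⇒∉⇒≢ x∈L y∉L refl = y∉L x∈L

bit : Bool → ℕ
bit b = if b then 1 else 0

count : (Fin n → Bool) → ℕ
count {zero}  p = 0
count {suc n} p = bit (p zero) + count (p ∘ suc)

bit-cover : ∀ {a b c} → (T a → T b ⊎ T c) → bit a ≤ bit b + bit c
bit-cover {false}                 _     = z≤n
bit-cover {true}  {true}          _     = s≤s z≤n
bit-cover {true}  {false} {true}  _     = s≤s z≤n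
bit-cover {true}  {false} {false} cover = ⊥-elim (Sum.reduce (cover _))

count-cover : (p q r : Fin n → Bool) → (∀ j → T (p j) → T (q j) ⊎ T (r j)) →
              count p ≤ count q + count r
count-cover {zero}  _ _ _ _     = z≤n
count-cover {suc n} p q r cover = begin
  bit (p zero) + count (p ∘ suc)
    ≤⟨ +-mono-≤ (bit-cover (cover zero))
                (count-cover (p ∘ suc) (q ∘ suc) (r ∘ suc) (cover ∘ suc)) ⟩
  (bit (q zero) + bit (r zero)) + (count (q ∘ suc) + count (r ∘ suc))
    ≡⟨ interchange (bit (q zero)) (bit (r zero)) (count (q ∘ suc)) (count (r ∘ suc)) ⟩
  count q + count r ∎
  where open ≤-Reasoning

count-∨ : (p q : Fin n → Bool) → count (λ j → p j ∨ q j) ≤ count p + count q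
count-∨ p q = count-cover _ p q (λ _ → Equivalence.to T-∨)

count-none : (p : Fin n → Bool) → (∀ j → ¬ T (p j)) → count p ≡ 0
count-none {zero}  p none = refl
count-none {suc n} p none with p zero | none zero
... | false | _   = count-none (p ∘ suc) (none ∘ suc)
... | true  | ¬p₀ = ⊥-elim (¬p₀ _)

count-mono : (p q : Fin n → Bool) → (∀ j → T (p j) → T (q j)) → count p ≤ count q
count-mono {n} p q p⊆q = begin
  count p                           ≤⟨ count-cover p q (const false) (λ j → inj₁ ∘ p⊆q j) ⟩
  count q + count {n} (const false) ≡⟨ cong (count q +_) (count-none {n} (const false) (λ _ ())) ⟩
  count q + 0                       ≡⟨ +-identityʳ (count q) ⟩
  count q                           ∎
  where open ≤-Reasoning

count-true : count {n} (const true) ≡ n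
count-true {zero}  = refl
count-true {suc n} = cong suc count-true

count-witness : (p : Fin n → Bool) → 1 ≤ count p → ∃ λ j → T (p j)
count-witness {suc n} p pos with p zero in p₀
... | true  = zero , subst T (sym p₀) _
... | false = Product.map suc id (count-witness (p ∘ suc) pos)

count-≤1 : (p : Fin n → Bool) → (∀ i j → T (p i) → T (p j) → i ≡ j) → count p ≤ 1
count-≤1 {zero}  p unique = z≤n
count-≤1 {suc n} p unique with p zero in p₀
... | false = count-≤1 (p ∘ suc) (λ i j pᵢ pⱼ → suc-injective (unique _ _ pᵢ pⱼ))
... | true  = s≤s (≤-reflexive (count-none (p ∘ suc) (λ j pⱼ →
                0≢1+n (unique zero (suc j) (subst T (sym p₀) _) pⱼ))))

count-≤-injection : ∀ {m} (p : Fin n → Bool) (g : ∀ j → T (p j) → Fin m) →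
                    (∀ i j pᵢ pⱼ → g i pᵢ ≡ g j pⱼ → i ≡ j) → count p ≤ m
count-≤-injection {zero}            p g injective = z≤n
count-≤-injection {suc n} {zero}    p g injective =
  ≤-reflexive (count-none p (λ j pⱼ → ¬Fin0 (g j pⱼ)))
count-≤-injection {suc n} {suc m} p g injective with p zero in p₀
... | false = count-≤-injection (p ∘ suc) (g ∘ suc) (λ i j pᵢ pⱼ →
                suc-injective ∘ injective _ _ pᵢ pⱼ)
... | true  = s≤s (count-≤-injection (p ∘ suc) (λ j pⱼ → punchOut (avoids j pⱼ)) (λ i j pᵢ pⱼ →
                suc-injective ∘ injective _ _ pᵢ pⱼ
                              ∘ punchOut-injective (avoids i pᵢ) (avoids j pⱼ)))
  where
  avoids : ∀ j pⱼ → g zero (subst T (sym p₀) _) ≢ g (suc j) pⱼ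
  avoids j pⱼ = 0≢1+n ∘ injective _ _ _ pⱼ

toFin : (Fin r → Bool) → Fin (2 ^ r)
toFin u = funToFin (Inverse.from 2↔Bool ∘ u)

toFin-injective : (u v : Fin r → Bool) → toFin u ≡ toFin v → u ≗ v
toFin-injective u v same c = begin
  u c                                             ≡⟨ Inverse.strictlyInverseˡ 2↔Bool (u c) ⟨
  Inverse.to 2↔Bool (Inverse.from 2↔Bool (u c))   ≡⟨ cong (Inverse.to 2↔Bool) (decode u) ⟨
  Inverse.to 2↔Bool (finToFun (toFin u) c)        ≡⟨ cong (λ x → Inverse.to 2↔Bool (finToFun x c)) same ⟩
  Inverse.to 2↔Bool (finToFun (toFin v) c)        ≡⟨ cong (Inverse.to 2↔Bool) (decode v) ⟩
  Inverse.to 2↔Bool (Inverse.from 2↔Bool (v c))   ≡⟨ Inverse.strictlyInverseˡ 2↔Bool (v c) ⟩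
  v c                                             ∎
  where
  open ≡-Reasoning
  decode : (w : Fin _ → Bool) → finToFun (toFin w) c ≡ Inverse.from 2↔Bool (w c)
  decode w = finToFun-funToFin (Inverse.from 2↔Bool ∘ w) c

distinctCodes⇒count≤2^ : (p : Fin n → Bool) (code : ∀ j → T (p j) → Fin r → Bool) →
                          (∀ i j pᵢ pⱼ → i ≢ j → ¬ code i pᵢ ≗ code j pⱼ) →
                          count p ≤ 2 ^ r
distinctCodes⇒count≤2^ p code distinct =
  count-≤-injection p (λ j pⱼ → toFin (code j pⱼ)) injective
  where
  injective : ∀ i j pᵢ pⱼ → toFin (code i pᵢ) ≡ toFin (code j pⱼ) → i ≡ j
  injective i j pᵢ pⱼ same with i ≟ j
  ... | yes i≡j = i≡j
  ... | no  i≢j = contradiction (toFin-injective _ _ same) (distinct i j pᵢ pⱼ i≢j)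

Matrix : ℕ → Set
Matrix n = Fin n → Fin n → Bool

_≢ᵇ_ : Fin n → Fin n → Bool
i ≢ᵇ j = not ⌊ i ≟ j ⌋

≢ᵇ⇒≢ : ∀ {i j : Fin n} → T (i ≢ᵇ j) → i ≢ j
≢ᵇ⇒≢ {i = i} {j} i≢ᵇj with i ≟ j
... | no i≢j = i≢j

count-offDiagonal : (i : Fin n) (p : Fin n → Bool) →
                    count p ≤ 1 + count (λ j → i ≢ᵇ j ∧ p j)
count-offDiagonal i p =
  ≤-trans (count-cover p (λ j → ⌊ i ≟ j ⌋) _ split) (+-monoˡ-≤ _ diagonal)
  where
  split : ∀ j → T (p j) → T ⌊ i ≟ j ⌋ ⊎ T (i ≢ᵇ j ∧ p j)
  split j pⱼ with i ≟ j
  ... | yes _ = inj₁ _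
  ... | no  _ = inj₂ pⱼ
  diagonal : count (λ j → ⌊ i ≟ j ⌋) ≤ 1
  diagonal = count-≤1 (λ j → ⌊ i ≟ j ⌋)
               (λ a b i≡a i≡b → trans (sym (toWitness i≡a)) (toWitness i≡b))

count-offDiagonal-witness : (i : Fin n) (p : Fin n → Bool) → 2 ≤ count p →
                            ∃ λ j → T (p j) × i ≢ j
count-offDiagonal-witness i p two with count-witness _ (≤-pred (≤-trans two (count-offDiagonal i p)))
... | j , i≢ᵇj∧pⱼ with Equivalence.to T-∧ i≢ᵇj∧pⱼ
...   | i≢ᵇj , pⱼ = j , pⱼ , ≢ᵇ⇒≢ i≢ᵇj

count-split : (p b : Fin n → Bool) →
              count p ≤ count (λ j → p j ∧ b j) + count (λ j → p j ∧ not (b j))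
count-split p b = count-cover p _ _ split
  where
  split : ∀ j → T (p j) → T (p j ∧ b j) ⊎ T (p j ∧ not (b j))
  split j pⱼ with b j
  ... | true  = inj₁ (Equivalence.from T-∧ (pⱼ , _))
  ... | false = inj₂ (Equivalence.from T-∧ (pⱼ , _))

module _ {n : ℕ} (m : Matrix n) where

  ones zeros : Fin n → ℕ
  ones  i = count λ j → i ≢ᵇ j ∧ m i j
  zeros i = count λ j → i ≢ᵇ j ∧ not (m i j)

  manyOnes manyZeros : Fin n → Bool
  manyOnes  i = 2 ≤ᵇ ones i
  manyZeros i = 2 ≤ᵇ zeros i

  row-length : (i : Fin n) → n ≤ 1 + (ones i + zeros i)
  row-length i = begin
    n                               ≡⟨ count-true {n} ⟨
    count {n} (const true)          ≤⟨ count-offDiagonal i _ ⟩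
    1 + count (λ j → i ≢ᵇ j ∧ true) ≤⟨ +-monoʳ-≤ 1 (count-mono _ (i ≢ᵇ_) (λ _ → proj₁ ∘ to T-∧)) ⟩
    1 + count (i ≢ᵇ_)               ≤⟨ +-monoʳ-≤ 1 (count-split (i ≢ᵇ_) (m i)) ⟩
    1 + (ones i + zeros i)          ∎
    where
    open ≤-Reasoning
    open Equivalence

record RankBounded (t : ℕ) (m : Matrix n) : Set where
  field
    ones-manyZeros  : ∀ i → count (λ j → i ≢ᵇ j ∧ (m i j ∧ manyZeros m j)) ≤ t
    zeros-manyOnes  : ∀ i → count (λ j → i ≢ᵇ j ∧ (not (m i j) ∧ manyOnes m j)) ≤ t
open RankBounded

¬2≤ᵇ⇒≤1 : ∀ x → ¬ T (2 ≤ᵇ x) → x ≤ 1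
¬2≤ᵇ⇒≤1 x few = ≤-pred (≰⇒> (few ∘ ≤⇒≤ᵇ))

module _ {n t : ℕ} {m : Matrix n} (bounded : RankBounded t m) where

  count-manyZeros-≤ : (i : Fin n) → ¬ T (manyZeros m i) → count (manyZeros m) ≤ 2 + t
  count-manyZeros-≤ i few = begin
    count (manyZeros m)
      ≤⟨ count-offDiagonal i _ ⟩
    1 + count (λ j → i ≢ᵇ j ∧ manyZeros m j)
      ≤⟨ +-monoʳ-≤ 1 (count-cover _ _ _ split) ⟩
    1 + (zeros m i + count (λ j → i ≢ᵇ j ∧ (m i j ∧ manyZeros m j)))
      ≤⟨ +-monoʳ-≤ 1 (+-mono-≤ (¬2≤ᵇ⇒≤1 (zeros m i) few) (ones-manyZeros bounded i)) ⟩
    2 + t ∎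
    where
    open ≤-Reasoning
    split : ∀ j → T (i ≢ᵇ j ∧ manyZeros m j) →
            T (i ≢ᵇ j ∧ not (m i j)) ⊎ T (i ≢ᵇ j ∧ (m i j ∧ manyZeros m j))
    split j with i ≢ᵇ j | m i j
    ... | false | _     = λ ()
    ... | true  | false = λ _ → inj₁ _
    ... | true  | true  = inj₂

  count-manyOnes-≤ : (∀ j → T (manyZeros m j)) → Fin n → count (manyOnes m) ≤ 1 + (t + t)
  count-manyOnes-≤ allManyZeros i = begin
    count (manyOnes m)
      ≤⟨ count-offDiagonal i _ ⟩
    1 + count (λ j → i ≢ᵇ j ∧ manyOnes m j)
      ≤⟨ +-monoʳ-≤ 1 (count-cover _ _ _ split) ⟩
    1 + (count (λ j → i ≢ᵇ j ∧ (m i j ∧ manyZeros m j)) +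
         count (λ j → i ≢ᵇ j ∧ (not (m i j) ∧ manyOnes m j)))
      ≤⟨ +-monoʳ-≤ 1 (+-mono-≤ (ones-manyZeros bounded i) (zeros-manyOnes bounded i)) ⟩
    1 + (t + t) ∎
    where
    open ≤-Reasoning
    split : ∀ j → T (i ≢ᵇ j ∧ manyOnes m j) →
            T (i ≢ᵇ j ∧ (m i j ∧ manyZeros m j)) ⊎
            T (i ≢ᵇ j ∧ (not (m i j) ∧ manyOnes m j))
    split j with i ≢ᵇ j | m i j | manyZeros m j | allManyZeros j
    ... | false | _     | _    | _ = λ ()
    ... | true  | true  | true | _ = λ _ → inj₁ _
    ... | true  | false | _    | _ = inj₂

manyZeros-of-sparseRow : (m : Matrix n) (i : Fin n) → 5 ≤ n → ones m i ≤ 1 → T (manyZeros m i)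
manyZeros-of-sparseRow {n} m i 5≤n sparse = ≤⇒≤ᵇ (≤-pred (≤-pred (begin
  4                          ≤⟨ n≤1+n 4 ⟩
  5                          ≤⟨ 5≤n ⟩
  n                          ≤⟨ row-length m i ⟩
  1 + (ones m i + zeros m i) ≤⟨ +-monoʳ-≤ 1 (+-monoˡ-≤ (zeros m i) sparse) ⟩
  2 + zeros m i              ∎)))
  where open ≤-Reasoning

rich-row-of-union : {l r m : Matrix n} → 5 ≤ n →
                    (∀ i j → T (m i j) → T (l i j) ⊎ T (r i j)) →
                    ∀ i → T (manyOnes l i ∨ (manyOnes r i ∨ manyZeros m i))
rich-row-of-union {n} {l} {r} {m} 5≤n m⊆l∪r i
  with manyOnes l i in poorₗ | manyOnes r i in poorᵣ | manyZeros m i in poorₘ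
... | true  | _     | _     = _
... | false | true  | _     = _
... | false | false | true  = _
... | false | false | false = contradiction short (<⇒≱ 5≤n)
  where
  open ≤-Reasoning
  ones-split : ∀ j → T (i ≢ᵇ j ∧ m i j) → T (i ≢ᵇ j ∧ l i j) ⊎ T (i ≢ᵇ j ∧ r i j)
  ones-split j h with Equivalence.to T-∧ h
  ... | i≢ᵇj , mᵢⱼ =
    Sum.map (Equivalence.from T-∧ ∘ (i≢ᵇj ,_)) (Equivalence.from T-∧ ∘ (i≢ᵇj ,_)) (m⊆l∪r i j mᵢⱼ)
  short : n ≤ 4
  short = begin
    n
      ≤⟨ row-length m i ⟩
    1 + (ones m i + zeros m i)
      ≤⟨ +-monoʳ-≤ 1 (+-monoˡ-≤ (zeros m i) (count-cover _ _ _ ones-split)) ⟩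
    1 + ((ones l i + ones r i) + zeros m i)
      ≤⟨ +-monoʳ-≤ 1 (+-mono-≤ (+-mono-≤ (¬2≤ᵇ⇒≤1 (ones l i) (subst T poorₗ))
                                         (¬2≤ᵇ⇒≤1 (ones r i) (subst T poorᵣ)))
                               (¬2≤ᵇ⇒≤1 (zeros m i) (subst T poorₘ))) ⟩
    4 ∎

⊑-trans : ∀ {A : Set} {s t u : BTree A} → s ⊑ t → t ⊑ u → s ⊑ u
⊑-trans s⊑t here        = s⊑t
⊑-trans s⊑t (left t⊑u)  = left (⊑-trans s⊑t t⊑u)
⊑-trans s⊑t (right t⊑u) = right (⊑-trans s⊑t t⊑u)

three-bounds : ∀ t → (1 + (t + t)) + ((1 + (t + t)) + (2 + t)) ≡ 4 + 5 * t
three-bounds = solve-∀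

module _ {A : Set} {n t : ℕ} (M : BTree A → Matrix n) {root : BTree A}
         (sparse-leaves : ∀ a i → ones (M (leaf a)) i ≤ 1)
         (node-⊆-∪ : ∀ l r i j → T (M (node l r) i j) → T (M l i j) ⊎ T (M r i j))
         (bounded : ∀ s → s ⊑ root → RankBounded t (M s))
         (large : 4 + 5 * t < n)
         where

  private
    5≤n : 5 ≤ n
    5≤n = ≤-trans (s≤s (m≤m+n 4 (5 * t))) large

  manyZeros-everywhere : ∀ s → s ⊑ root → ∀ i → T (manyZeros (M s) i)
  manyZeros-everywhere (leaf a)   _      i =
    manyZeros-of-sparseRow (M (leaf a)) i 5≤n (sparse-leaves a i)
  manyZeros-everywhere (node l r) s⊑root i with T? (manyZeros (M (node l r)) i)
  ... | yes rich = rich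
  ... | no  poor = contradiction rows (<⇒≱ large)
    where
    open ≤-Reasoning
    l⊑root : l ⊑ root
    l⊑root = ⊑-trans (left here) s⊑root
    r⊑root : r ⊑ root
    r⊑root = ⊑-trans (right here) s⊑root
    rows : n ≤ 4 + 5 * t
    rows = begin
      n
        ≡⟨ count-true {n} ⟨
      count {n} (const true)
        ≤⟨ count-mono _ _ (λ j _ → rich-row-of-union 5≤n (node-⊆-∪ l r) j) ⟩
      count (λ j → manyOnes (M l) j ∨ (manyOnes (M r) j ∨ manyZeros (M (node l r)) j))
        ≤⟨ count-∨ (manyOnes (M l)) _ ⟩
      count (manyOnes (M l)) + count (λ j → manyOnes (M r) j ∨ manyZeros (M (node l r)) j)
        ≤⟨ +-monoʳ-≤ _ (count-∨ (manyOnes (M r)) (manyZeros (M (node l r)))) ⟩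
      count (manyOnes (M l)) + (count (manyOnes (M r)) + count (manyZeros (M (node l r))))
        ≤⟨ +-mono-≤ (count-manyOnes-≤ (bounded l l⊑root) (manyZeros-everywhere l l⊑root) i)
                    (+-mono-≤ (count-manyOnes-≤ (bounded r r⊑root) (manyZeros-everywhere r r⊑root) i)
                              (count-manyZeros-≤ (bounded (node l r) s⊑root) i poor)) ⟩
      (1 + (t + t)) + ((1 + (t + t)) + (2 + t))
        ≡⟨ three-bounds t ⟩
      4 + 5 * t ∎

dot-cong : ∀ {u u′ v v′ : Fin r → Bool} → u ≗ u′ → v ≗ v′ → dot r u v ≡ dot r u′ v′
dot-cong {zero}  u≗u′ v≗v′ = refl
dot-cong {suc r} u≗u′ v≗v′ =
  cong₂ _xor_ (cong₂ _∧_ (u≗u′ zero) (v≗v′ zero)) (dot-cong (u≗u′ ∘ suc) (v≗v′ ∘ suc))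

module CutRank {G : Graph} {X : V G → Set} {r : ℕ}
               (B : V G → Fin r → Bool) (C : Fin r → V G → Bool)
               (rank : ∀ x y → X x → ¬ X y → (Adj G x y ⇔ T (dot r (B x) (λ i → C i y))))
               where

  adj-of-sameRow : ∀ {x x′ y} → X x → X x′ → ¬ X y → B x ≗ B x′ → Adj G x y → Adj G x′ y
  adj-of-sameRow x∈X x′∈X y∉X same xy =
    Equivalence.from (rank _ _ x′∈X y∉X)
      (subst T (dot-cong same (λ _ → refl)) (Equivalence.to (rank _ _ x∈X y∉X) xy))

  adj-of-sameColumn : ∀ {x y y′} → X x → ¬ X y → ¬ X y′ →
                      (λ i → C i y) ≗ (λ i → C i y′) → Adj G x y → Adj G x y′
  adj-of-sameColumn x∈X y∉X y′∉X same xy =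
    Equivalence.from (rank _ _ x∈X y′∉X)
      (subst T (dot-cong (λ _ → refl) same) (Equivalence.to (rank _ _ x∈X y∉X) xy))

Ke-Adj-sym : ∀ {V adj lt e f} → Adj (Ke V adj lt) e f → Adj (Ke V adj lt) f e
Ke-Adj-sym (e≢f , C , clique , e₁ , e₂ , f₁ , f₂) = e≢f ∘ sym , C , clique , f₁ , f₂ , e₁ , e₂

cpAdj-≢ : ∀ {a b : Fin n} s t → a ≢ b → T (cpAdj n (a , s) (b , t))
cpAdj-≢ _ _ a≢b = Equivalence.from T-not-≡ᵇ (a≢b ∘ toℕ-injective)

two-sided-clique : (As Bs : List (Fin n)) → (∀ {a b} → a ∈ As → b ∈ Bs → a ≢ b) →
                   IsClique (cpAdj n) (map (_, true) As ++ map (_, false) Bs)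
two-sided-clique {n} As Bs disjoint (a , s) (b , t) a∈ b∈ distinct with side a∈ | side b∈
  where
  side : ∀ {x} → x ∈ map (_, true) As ++ map (_, false) Bs →
         (proj₁ x ∈ As × proj₂ x ≡ true) ⊎ (proj₁ x ∈ Bs × proj₂ x ≡ false)
  side x∈ with ∈-++⁻ (map (_, true) As) x∈
  ... | inj₁ x∈As with ∈-map⁻ (_, true) x∈As
  ...   | _ , a∈As , refl = inj₁ (a∈As , refl)
  side x∈ | inj₂ x∈Bs with ∈-map⁻ (_, false) x∈Bs
  ...   | _ , b∈Bs , refl = inj₂ (b∈Bs , refl)
... | inj₁ (_   , refl) | inj₁ (_   , refl) = cpAdj-≢ true  true  (distinct ∘ cong (_, true))
... | inj₁ (a∈A , refl) | inj₂ (b∈B , refl) = cpAdj-≢ true  false (disjoint a∈A b∈B)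
... | inj₂ (a∈B , refl) | inj₁ (b∈A , refl) = cpAdj-≢ false true  (disjoint b∈A a∈B ∘ sym)
... | inj₂ (_   , refl) | inj₂ (_   , refl) = cpAdj-≢ false false (distinct ∘ cong (_, false))

Edge : ℕ → Set
Edge n = V (KeCp n)

EndsIn : List (cpV n) → Edge n → Set
EndsIn C e = proj₁ (proj₁ e) ∈ C × proj₂ (proj₁ e) ∈ C

oriented : ∀ {a b} c → a < b → T (((a <ᵇ b) ∨ c) ∧ not (a ≡ᵇ b))
oriented _ a<b = Equivalence.from T-∧
  (Equivalence.from T-∨ (inj₁ (<⇒<ᵇ a<b)) , Equivalence.from T-not-≡ᵇ (<⇒≢ a<b))

cell : (i j : Fin n) → .(i ≢ j) → Edge n
cell i j i≢j with <-cmp (toℕ i) (toℕ j)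
... | tri< i<j _ _ = ((i , true) , (j , false)) , oriented _ i<j
... | tri≈ _ i≡j _ = Irrelevant.⊥-elim (i≢j (toℕ-injective i≡j))
... | tri> _ _ j<i = ((j , false) , (i , true)) , oriented _ j<i

cell-endsIn : ∀ {C} (i j : Fin n) .(i≢j : i ≢ j) →
              EndsIn C (cell i j i≢j) ⇔ ((i , true) ∈ C × (j , false) ∈ C)
cell-endsIn i j i≢j with <-cmp (toℕ i) (toℕ j)
... | tri< _ _   _ = mk⇔ id id
... | tri≈ _ i≡j _ = Irrelevant.⊥-elim (i≢j (toℕ-injective i≡j))
... | tri> _ _   _ = mk⇔ Product.swap Product.swap

cell-injective : ∀ (i j i′ j′ : Fin n) .(i≢j : i ≢ j) .(i′≢j′ : i′ ≢ j′) →
                 cell i j i≢j ≡ cell i′ j′ i′≢j′ → i ≡ i′ × j ≡ j′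
cell-injective {n} i j i′ j′ i≢j i′≢j′ same =
  true-end (proj₁ ends) , false-end (proj₂ ends)
  where
  C : List (cpV n)
  C = (i′ , true) ∷ (j′ , false) ∷ []
  ends : (i , true) ∈ C × (j , false) ∈ C
  ends = Equivalence.to (cell-endsIn i j i≢j) (subst (EndsIn C) (sym same)
           (Equivalence.from (cell-endsIn i′ j′ i′≢j′) (here refl , there (here refl))))
  true-end : (i , true) ∈ C → i ≡ i′
  true-end (here refl)         = refl
  true-end (there (here ()))
  true-end (there (there ()))
  false-end : (j , false) ∈ C → j ≡ j′
  false-end (here ())
  false-end (there (here refl)) = refl
  false-end (there (there ()))

KeCp-nontrivial : ¬ (∀ (e f : Edge (2 + n)) → e ≡ f)
KeCp-nontrivial trivial =
  0≢1+n (proj₁ (cell-injective zero (suc zero) (suc zero) zero (λ ()) (λ ()) (trivial _ _)))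

cells-nonadjacent : ∀ {i j l : Fin n} .(i≢j : i ≢ j) .(j≢l : j ≢ l) →
                    ¬ Adj (KeCp n) (cell i j i≢j) (cell j l j≢l)
cells-nonadjacent {i = i} {j} {l} i≢j j≢l (_ , C , clique , e₁ , e₂ , f₁ , f₂) =
  Equivalence.to (T-not-≡ᵇ {toℕ j}) (clique (j , false) (j , true) jF∈C jT∈C (λ ())) refl
  where
  jF∈C : (j , false) ∈ C
  jF∈C = proj₂ (Equivalence.to (cell-endsIn i j i≢j) (e₁ , e₂))
  jT∈C : (j , true) ∈ C
  jT∈C = proj₁ (Equivalence.to (cell-endsIn j l j≢l) (f₁ , f₂))

cells-adjacent : ∀ {i j k l : Fin n} (i≢j : i ≢ j) (k≢l : k ≢ l) → i ≢ l → k ≢ j →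
                 cell i j i≢j ≢ cell k l k≢l → Adj (KeCp n) (cell i j i≢j) (cell k l k≢l)
cells-adjacent {n} {i} {j} {k} {l} i≢j k≢l i≢l k≢j distinct =
  distinct , C , two-sided-clique (i ∷ k ∷ []) (j ∷ l ∷ []) disjoint ,
  proj₁ ends₁ , proj₂ ends₁ , proj₁ ends₂ , proj₂ ends₂
  where
  C : List (cpV n)
  C = (i , true) ∷ (k , true) ∷ (j , false) ∷ (l , false) ∷ []
  ends₁ : EndsIn C (cell i j i≢j)
  ends₁ = Equivalence.from (cell-endsIn i j i≢j) (here refl , there (there (here refl)))
  ends₂ : EndsIn C (cell k l k≢l)
  ends₂ = Equivalence.from (cell-endsIn k l k≢l)
            (there (here refl) , there (there (there (here refl))))
  disjoint : ∀ {a b} → a ∈ i ∷ k ∷ [] → b ∈ j ∷ l ∷ [] → a ≢ b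
  disjoint (here refl)         (here refl)         = i≢j
  disjoint (here refl)         (there (here refl)) = i≢l
  disjoint (there (here refl)) (here refl)         = k≢j
  disjoint (there (here refl)) (there (here refl)) = k≢l

Edge-≟ : DecidableEquality (Edge n)
Edge-≟ = ≡-dec (≡-dec (≡-dec _≟_ Bool._≟_) (≡-dec _≟_ Bool._≟_))
               (λ _ _ → yes (T-irrelevant _ _))

module _ {n : ℕ} where
  open DecMembership (Edge-≟ {n}) using (_∈?_)

  cellMatrix : List (Edge n) → Matrix n
  cellMatrix L i j with i ≟ j
  ... | yes _   = false
  ... | no  i≢j = ⌊ cell i j i≢j ∈? L ⌋

  cellMatrix⁺ : ∀ {L i j} (i≢j : i ≢ j) → cell i j i≢j ∈ L → T (cellMatrix L i j)
  cellMatrix⁺ {i = i} {j} i≢j e∈L with i ≟ j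
  ... | yes i≡j = i≢j i≡j
  ... | no  _   = fromWitness e∈L

  cellMatrix⁻ : ∀ {L i j} → T (cellMatrix L i j) → Σ (i ≢ j) λ i≢j → cell i j i≢j ∈ L
  cellMatrix⁻ {i = i} {j} h with i ≟ j
  ... | no i≢j = i≢j , toWitness h

cellMatrix-∉ : ∀ {L : List (Edge n)} {i j} (i≢j : i ≢ j) →
               T (not (cellMatrix L i j)) → cell i j i≢j ∉ L
cellMatrix-∉ i≢j h e∈L = subst T (Equivalence.to Bool.T-not-≡ h) (cellMatrix⁺ i≢j e∈L)

cellMatrix-entry : (L : List (Edge n)) (i j : Fin n) → T (i ≢ᵇ j ∧ cellMatrix L i j) →
                   Σ (i ≢ j) λ i≢j → cell i j i≢j ∈ L
cellMatrix-entry L i j h =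
  cellMatrix⁻ {L = L} {i} {j} (proj₂ (Equivalence.to (T-∧ {i ≢ᵇ j}) h))

cellMatrix-non-entry : (L : List (Edge n)) (i j : Fin n) →
                       T (i ≢ᵇ j ∧ not (cellMatrix L i j)) →
                       Σ (i ≢ j) λ i≢j → cell i j i≢j ∉ L
cellMatrix-non-entry L i j h with Equivalence.to (T-∧ {i ≢ᵇ j}) h
... | i≢ᵇj , ¬mᵢⱼ = ≢ᵇ⇒≢ i≢ᵇj , cellMatrix-∉ {L = L} (≢ᵇ⇒≢ i≢ᵇj) ¬mᵢⱼ

cellMatrix-++ : (L L′ : List (Edge n)) (i j : Fin n) →
                T (cellMatrix (L ++ L′) i j) → T (cellMatrix L i j) ⊎ T (cellMatrix L′ i j)
cellMatrix-++ L L′ i j h with cellMatrix⁻ {L = L ++ L′} {i} {j} h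
... | i≢j , e∈L++L′ = Sum.map (cellMatrix⁺ i≢j) (cellMatrix⁺ i≢j) (∈-++⁻ L e∈L++L′)

cellMatrix-singleton : (e : Edge n) (i : Fin n) → ones (cellMatrix (e ∷ [])) i ≤ 1
cellMatrix-singleton e i = count-≤1 (λ j → i ≢ᵇ j ∧ m i j) same-column
  where
  m : Matrix _
  m = cellMatrix (e ∷ [])
  same-column : ∀ a b → T (i ≢ᵇ a ∧ m i a) → T (i ≢ᵇ b ∧ m i b) → a ≡ b
  same-column a b hₐ h_b with cellMatrix-entry (e ∷ []) i a hₐ | cellMatrix-entry (e ∷ []) i b h_b
  ... | i≢a , here cellₐ≡e | i≢b , here cell_b≡e =
    proj₂ (cell-injective i a i b i≢a i≢b (trans cellₐ≡e (sym cell_b≡e)))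

cellMatrix-complete⇒¬manyZeros : (L : List (Edge n)) → (∀ e → e ∈ L) →
                                 (i : Fin n) → ¬ T (manyZeros (cellMatrix L) i)
cellMatrix-complete⇒¬manyZeros L complete i many =
  contradiction (≤-trans (≤ᵇ⇒≤ 2 _ many) (≤-reflexive no-zeros)) λ ()
  where
  no-zeros : zeros (cellMatrix L) i ≡ 0
  no-zeros = count-none _ (λ j h → proj₂ (cellMatrix-non-entry L i j h) (complete _))

module _ {n k : ℕ} (L : List (Edge n)) (B : Edge n → Fin k → Bool) (C : Fin k → Edge n → Bool)
         (rank : ∀ x y → x ∈ L → y ∉ L →
                 (Adj (KeCp n) x y ⇔ T (dot k (B x) (λ c → C c y))))
         where
  open CutRank B C rank

  private
    m : Matrix n
    m = cellMatrix L

    entry : ∀ i j → T (i ≢ᵇ j ∧ m i j) → Σ (i ≢ j) λ i≢j → cell i j i≢j ∈ L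
    entry = cellMatrix-entry L

    non-entry : ∀ i j → T (i ≢ᵇ j ∧ not (m i j)) → Σ (i ≢ j) λ i≢j → cell i j i≢j ∉ L
    non-entry = cellMatrix-non-entry L

  ones-manyZeros-bounded : ∀ i → count (λ j → i ≢ᵇ j ∧ (m i j ∧ manyZeros m j)) ≤ 2 ^ k
  ones-manyZeros-bounded i = distinctCodes⇒count≤2^ _ code separated
    where
    code : ∀ j → T (i ≢ᵇ j ∧ (m i j ∧ manyZeros m j)) → Fin k → Bool
    code j h = B (cell i j (proj₁ (entry i j (proj₁ (∧-reassoc (i ≢ᵇ j) (m i j) h)))))
    separated : ∀ j j′ hⱼ hⱼ′ → j ≢ j′ → ¬ code j hⱼ ≗ code j′ hⱼ′
    separated j j′ hⱼ hⱼ′ j≢j′ same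
      with ∧-reassoc (i ≢ᵇ j) (m i j) hⱼ | ∧-reassoc (i ≢ᵇ j′) (m i j′) hⱼ′
    ... | entryⱼ , many | entryⱼ′ , _
      with entry i j entryⱼ | entry i j′ entryⱼ′
         | count-offDiagonal-witness i (λ l → j ≢ᵇ l ∧ not (m j l)) (≤ᵇ⇒≤ 2 _ many)
    ... | i≢j , x∈L | i≢j′ , x′∈L | l , zeroⱼₗ , i≢l with non-entry j l zeroⱼₗ
    ... | j≢l , y∉L =
      cells-nonadjacent i≢j j≢l (adj-of-sameRow x′∈L x∈L y∉L (sym ∘ same)
        (cells-adjacent i≢j′ j≢l i≢l j≢j′ (∈⇒∉⇒≢ x′∈L y∉L)))

  zeros-manyOnes-bounded :
    ∀ i → count (λ j → i ≢ᵇ j ∧ (not (m i j) ∧ manyOnes m j)) ≤ 2 ^ k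
  zeros-manyOnes-bounded i = distinctCodes⇒count≤2^ _ code separated
    where
    code : ∀ j → T (i ≢ᵇ j ∧ (not (m i j) ∧ manyOnes m j)) → Fin k → Bool
    code j h c =
      C c (cell i j (proj₁ (non-entry i j (proj₁ (∧-reassoc (i ≢ᵇ j) (not (m i j)) h)))))
    separated : ∀ j j′ hⱼ hⱼ′ → j ≢ j′ → ¬ code j hⱼ ≗ code j′ hⱼ′
    separated j j′ hⱼ hⱼ′ j≢j′ same
      with ∧-reassoc (i ≢ᵇ j) (not (m i j)) hⱼ | ∧-reassoc (i ≢ᵇ j′) (not (m i j′)) hⱼ′
    ... | non-entryⱼ , many | non-entryⱼ′ , _
      with non-entry i j non-entryⱼ | non-entry i j′ non-entryⱼ′
         | count-offDiagonal-witness i (λ l → j ≢ᵇ l ∧ m j l) (≤ᵇ⇒≤ 2 _ many)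
    ... | i≢j , y∉L | i≢j′ , y′∉L | l , oneⱼₗ , i≢l with entry j l oneⱼₗ
    ... | j≢l , x∈L =
      cells-nonadjacent i≢j j≢l (Ke-Adj-sym (adj-of-sameColumn x∈L y′∉L y∉L (sym ∘ same)
        (cells-adjacent j≢l i≢j′ j≢j′ i≢l (∈⇒∉⇒≢ x∈L y′∉L))))

cutRank⇒rankBounded : ∀ {k} (L : List (Edge n)) → CutRankAtMost (KeCp n) (_∈ L) k →
                      RankBounded (2 ^ k) (cellMatrix L)
cutRank⇒rankBounded L (B , C , rank) = record
  { ones-manyZeros = ones-manyZeros-bounded L B C rank
  ; zeros-manyOnes = zeros-manyOnes-bounded L B C rank
  }

theorem7 : ∀ (k : ℕ) → ∃ λ (n : ℕ) → ¬ RankwidthAtMost k (KeCp n)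
theorem7 k = 5 + 5 * 2 ^ k , λ where
    (inj₁ trivial)                       → KeCp-nontrivial trivial
    (inj₂ (t , (_ , complete) , narrow)) →
      cellMatrix-complete⇒¬manyZeros (leaves t) complete zero
        (manyZeros-everywhere (cellMatrix ∘ leaves)
           cellMatrix-singleton
           (λ l r → cellMatrix-++ (leaves l) (leaves r))
           (λ s s⊑t → cutRank⇒rankBounded (leaves s) (narrow s s⊑t))
           ≤-refl t here zero)
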